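{- Let $k$ be a commutative ring, $X,Y$ finite posets, $F:Y\to\mathcal{J}(X)$ order-preserving, $\Gamma$ the associated poset of generalized intervals, and $y\in Y$. Then: (1) for every $x\in F(y)$, the functor $(i_y)_\star$ sends the injective functor $I_x\in\mathcal{F}_{F(y),k}$ to (a functor isomorphic to) the injective functor $I_{(x,y)}\in\mathcal{F}_{\Gamma,k}$; (2) the two functors $i_y^{ -1}$ and $(i_y)_\star$ are exact.
   Context: For a poset $P$, $\mathcal{C}_P$ is the category with objects the elements of $P$ and exactly one morphism $p\to p'$ if $p\leqslant p'$, none otherwise, $k\mathcal{C}_P$ its $k$-linearization, and $\mathcal{F}_{P,k}$ the abelian category of $k$-linear functors $k\mathcal{C}_P\to k\text{ -Mod}$ (abelian structure pointwise). For $p\in P$, $I_p:=\mathrm{Hom}_{k\mathcal{C}_P}(-,p)^{*}$ (the $k$-dual), so $I_p(z)=k$ if $z\leqslant p$ and $0$ otherwise. $\mathcal{J}(X)$ is the poset, under inclusion, of closed subsets $Z\subseteq X$ ($x\in Z$, $x'\leqslant x$ imply $x'\in Z$); $F$ order-preserving means $F(y)\subseteq F(y')$ for $y\leqslant y'$. $\Gamma=\{(x,y)\in X\times Y: x\in F(y)\}$ with the order induced from the product order. $F(y)$ is a subposet of $X$. $i_y^{ -1}:\mathcal{F}_{\Gamma,k}\to\mathcal{F}_{F(y),k}$ is restriction along $x\mapsto(x,y)$: $(i_y^{ -1}\psi)(x)=\psi(x,y)$. For $\phi\in\mathcal{F}_{F(y),k}$, $(i_y)_\star\phi(a,b)=\mathrm{Hom}_k\big(\mathrm{Hom}_{k\mathcal{C}_\Gamma}((a,b),(a,y)),\phi(a)\big)\cong\phi(a)$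 if $b\leqslant y$ and $0$ otherwise, the morphism $(a,b)\to(c,d)$ being sent to $\phi(a\to c)$ if $d\leqslant y$ and to $0$ otherwise, and a natural transformation $\eta$ being sent to the transformation with components $\eta_a$ at $(a,b)$, $b\leqslant y$. -}

module Defs where

open import Level using (Level; _⊔_; suc; 0ℓ)
open import Data.Bool using (Bool; true; false; T; _∧_)
open import Data.Bool.Properties using (T-∧)
open import Data.Nat using (ℕ)
open import Data.Fin using (Fin)
open import Data.Product using (Σ; ∃; _×_; _,_; proj₁; proj₂)
open import Function.Base using (_∘_; id)
open import Function.Bundles using (_↔_; Equivalence)
open import Relation.Binary.PropositionalEquality using (_≡_; refl)
open import Algebra.Bundles using (CommutativeRing)
open import Algebra.Module.Bundles using (Module)
open import Algebra.Module.Morphism.Structures using (IsModuleHomomorphism)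
import Algebra.Module.Morphism.Construct.Composition as Comp
import Algebra.Module.Morphism.Construct.Identity as Ident
import Algebra.Module.Construct.TensorUnit as TensorUnit

-- A poset is a set with a *decidable* (Bool-valued) partial
-- order; p ≤ q is the proposition T (leq p q), which has at most one
-- proof, so C_P (one morphism p → q iff p ≤ q) is a thin category.

record BoolPoset : Set₁ where
  field
    Carrier : Set
    leq     : Carrier → Carrier → Bool
    ≤-refl    : ∀ x → T (leq x x)
    ≤-antisym : ∀ {x y} → T (leq x y) → T (leq y x) → x ≡ y
    ≤-trans   : ∀ {x y z} → T (leq x y) → T (leq y z) → T (leq x z)

  infix 4 _≤_
  _≤_ : Carrier → Carrier → Set
  x ≤ y = T (leq x y)

open BoolPoset public using (Carrier)

IsFinite : BoolPoset → Set
IsFinite P = Σ ℕ λ n → Carrier P ↔ Fin n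

_×ᴾ_ : BoolPoset → BoolPoset → BoolPoset
X ×ᴾ Y = record
  { Carrier   = Carrier X × Carrier Y
  ; leq       = λ p q → X.leq (proj₁ p) (proj₁ q) ∧ Y.leq (proj₂ p) (proj₂ q)
  ; ≤-refl    = λ p → Equivalence.from T-∧ (X.≤-refl (proj₁ p) , Y.≤-refl (proj₂ p))
  ; ≤-antisym = λ h h' → antisym (Equivalence.to T-∧ h) (Equivalence.to T-∧ h')
  ; ≤-trans   = λ h h' → Equivalence.from T-∧
      ( X.≤-trans (proj₁ (Equivalence.to T-∧ h)) (proj₁ (Equivalence.to T-∧ h'))
      , Y.≤-trans (proj₂ (Equivalence.to T-∧ h)) (proj₂ (Equivalence.to T-∧ h')))
  }
  where
  module X = BoolPoset X
  module Y = BoolPoset Y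
  antisym : ∀ {p q : Carrier X × Carrier Y} →
            T (X.leq (proj₁ p) (proj₁ q)) × T (Y.leq (proj₂ p) (proj₂ q)) →
            T (X.leq (proj₁ q) (proj₁ p)) × T (Y.leq (proj₂ q) (proj₂ p)) → p ≡ q
  antisym (a , b) (a' , b') with X.≤-antisym a a' | Y.≤-antisym b b'
  ... | refl | refl = refl

-- an element of the subset { p | T (S p) }; the membership proof is
-- irrelevant, so elements are determined by their underlying element
record SubElt (P : BoolPoset) (S : Carrier P → Bool) : Set where
  constructor ⟨_,_⟩
  field
    elt  : Carrier P
    .mem : T (S elt)
open SubElt public

Sub : (P : BoolPoset) → (Carrier P → Bool) → BoolPoset
Sub P S = record
  { Carrier   = SubElt P S
  ; leq       = λ p q → P.leq (elt p) (elt q)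
  ; ≤-refl    = λ p → P.≤-refl (elt p)
  ; ≤-antisym = antisym
  ; ≤-trans   = P.≤-trans
  }
  where
  module P = BoolPoset P
  antisym : ∀ {p q : SubElt P S} → T (P.leq (elt p) (elt q)) → T (P.leq (elt q) (elt p)) → p ≡ q
  antisym {⟨ x , _ ⟩} {⟨ y , _ ⟩} h h' with P.≤-antisym h h'
  ... | refl = refl

-- Order-preserving maps F : Y → J(X), where J(X) is the poset under
-- inclusion of closed (down-closed) subsets of X.  A subset of X is
-- given by its (Bool-valued) characteristic function.

record ToJ (X Y : BoolPoset) : Set where
  module X = BoolPoset X
  module Y = BoolPoset Y
  field
    F      : Carrier Y → Carrier X → Bool
    closed : ∀ y {x x'} → x' X.≤ x → T (F y x) → T (F y x')
    mono   : ∀ {y y'} → y Y.≤ y' → ∀ x → T (F y x) → T (F y' x)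

module _ {X Y : BoolPoset} (𝔽 : ToJ X Y) where
  open ToJ 𝔽

  Γ : BoolPoset
  Γ = Sub (X ×ᴾ Y) (λ p → F (proj₂ p) (proj₁ p))

  Fᴾ : Carrier Y → BoolPoset
  Fᴾ y = Sub X (F y)

  incl : (y : Carrier Y) → Carrier (Fᴾ y) → Carrier Γ
  incl y ⟨ x , m ⟩ = ⟨ (x , y) , m ⟩

module _ {c ℓ : Level} (k : CommutativeRing c ℓ) where

  private
    module K = CommutativeRing k

  record LinMap {m₁ ℓ₁ m₂ ℓ₂} (M : Module k m₁ ℓ₁) (N : Module k m₂ ℓ₂)
                : Set (c ⊔ m₁ ⊔ m₂ ⊔ ℓ₁ ⊔ ℓ₂) where
    constructor mkLin
    field
      ⟦_⟧    : Module.Carrierᴹ M → Module.Carrierᴹ N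
      isLin  : IsModuleHomomorphism (Module.rawModule M) (Module.rawModule N) ⟦_⟧
  open LinMap public

  idLin : ∀ {m ℓm} (M : Module k m ℓm) → LinMap M M
  idLin M = mkLin id (Ident.isModuleHomomorphism (Module.rawModule M) (Module.≈ᴹ-refl M))

  _∘Lin_ : ∀ {m ℓm} {M₁ M₂ M₃ : Module k m ℓm} → LinMap M₂ M₃ → LinMap M₁ M₂ → LinMap M₁ M₃
  _∘Lin_ {M₃ = M₃} g f = mkLin (⟦ g ⟧ ∘ ⟦ f ⟧)
    (Comp.isModuleHomomorphism (Module.≈ᴹ-trans M₃) (isLin f) (isLin g))

  -- For A = Hom(p,q)
  -- in a thin category this is Hom_k(k Hom(p,q), M) ≅ M^{Hom(p,q)}.
  Πᴹ : ∀ {m ℓm} (A : Set) → (.A → Module k m ℓm) → Module k m ℓm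
  Πᴹ {m} {ℓm} A M = record
    { Carrierᴹ = .(a : A) → Module.Carrierᴹ (M a)
    ; _≈ᴹ_ = λ f g → .(a : A) → Module._≈ᴹ_ (M a) (f a) (g a)
    ; _+ᴹ_ = λ f g a → Module._+ᴹ_ (M a) (f a) (g a)
    ; _*ₗ_ = λ r f a → Module._*ₗ_ (M a) r (f a)
    ; _*ᵣ_ = λ f r a → Module._*ᵣ_ (M a) (f a) r
    ; 0ᴹ = λ a → Module.0ᴹ (M a)
    ; -ᴹ_ = λ f a → Module.-ᴹ_ (M a) (f a)
    ; isModule = record
      { isBimodule = record
        { isBisemimodule = record
          { +ᴹ-isCommutativeMonoid = record
            { isMonoid = record
              { isSemigroup = record
                { isMagma = record
                  { isEquivalence = record
                    { refl = λ a → Module.≈ᴹ-refl (M a)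
                    ; sym = λ e a → Module.≈ᴹ-sym (M a) (e a)
                    ; trans = λ e e' a → Module.≈ᴹ-trans (M a) (e a) (e' a)
                    }
                  ; ∙-cong = λ e e' a → Module.+ᴹ-cong (M a) (e a) (e' a)
                  }
                ; assoc = λ f g h a → Module.+ᴹ-assoc (M a) (f a) (g a) (h a)
                }
              ; identity = (λ f a → Module.+ᴹ-identityˡ (M a) (f a))
                         , (λ f a → Module.+ᴹ-identityʳ (M a) (f a))
              }
            ; comm = λ f g a → Module.+ᴹ-comm (M a) (f a) (g a)
            }
          ; isPreleftSemimodule = record
            { *ₗ-cong = λ e e' a → Module.*ₗ-cong (M a) e (e' a)
            ; *ₗ-zeroˡ = λ f a → Module.*ₗ-zeroˡ (M a) (f a)
            ; *ₗ-distribʳ = λ f r s a → Module.*ₗ-distribʳ (M a) (f a) r s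
            ; *ₗ-identityˡ = λ f a → Module.*ₗ-identityˡ (M a) (f a)
            ; *ₗ-assoc = λ r s f a → Module.*ₗ-assoc (M a) r s (f a)
            ; *ₗ-zeroʳ = λ r a → Module.*ₗ-zeroʳ (M a) r
            ; *ₗ-distribˡ = λ r f g a → Module.*ₗ-distribˡ (M a) r (f a) (g a)
            }
          ; isPrerightSemimodule = record
            { *ᵣ-cong = λ e e' a → Module.*ᵣ-cong (M a) (e a) e'
            ; *ᵣ-zeroʳ = λ f a → Module.*ᵣ-zeroʳ (M a) (f a)
            ; *ᵣ-distribˡ = λ f r s a → Module.*ᵣ-distribˡ (M a) (f a) r s
            ; *ᵣ-identityʳ = λ f a → Module.*ᵣ-identityʳ (M a) (f a)
            ; *ᵣ-assoc = λ f r s a → Module.*ᵣ-assoc (M a) (f a) r s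
            ; *ᵣ-zeroˡ = λ r a → Module.*ᵣ-zeroˡ (M a) r
            ; *ᵣ-distribʳ = λ r f g a → Module.*ᵣ-distribʳ (M a) r (f a) (g a)
            }
          ; *ₗ-*ᵣ-assoc = λ r f s a → Module.*ₗ-*ᵣ-assoc (M a) r (f a) s
          }
        ; -ᴹ‿cong = λ e a → Module.-ᴹ‿cong (M a) (e a)
        ; -ᴹ‿inverse = (λ f a → Module.-ᴹ‿inverseˡ (M a) (f a))
                     , (λ f a → Module.-ᴹ‿inverseʳ (M a) (f a))
        }
      ; *ₗ-*ᵣ-coincident = λ r f a → Module.*ₗ-*ᵣ-coincident (M a) r (f a)
      }
    }

  Πmap : ∀ {m ℓm} {A B : Set} {M : .A → Module k m ℓm} {N : .B → Module k m ℓm}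
         .(τ : B → A) (L : .(b : B) → LinMap (M (τ b)) (N b)) →
         LinMap (Πᴹ A M) (Πᴹ B N)
  Πmap {M = M} {N} τ L = mkLin (λ s b → ⟦ L b ⟧ (s (τ b))) (record
    { isBimoduleHomomorphism = record
      { +ᴹ-isGroupHomomorphism = record
        { isMonoidHomomorphism = record
          { isMagmaHomomorphism = record
            { isRelHomomorphism = record
              { cong = λ e b → IsModuleHomomorphism.⟦⟧-cong (isLin (L b)) (e (τ b)) }
            ; homo = λ s t b → IsModuleHomomorphism.+ᴹ-homo (isLin (L b)) (s (τ b)) (t (τ b))
            }
          ; ε-homo = λ b → IsModuleHomomorphism.0ᴹ-homo (isLin (L b))
          }
        ; ⁻¹-homo = λ s b → IsModuleHomomorphism.-ᴹ-homo (isLin (L b)) (s (τ b))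
        }
      ; *ₗ-homo = λ r s b → IsModuleHomomorphism.*ₗ-homo (isLin (L b)) r (s (τ b))
      ; *ᵣ-homo = λ r s b → IsModuleHomomorphism.*ᵣ-homo (isLin (L b)) r (s (τ b))
      }
    })

  -- The category F_{P,k}: k-linear functors k C_P → k-Mod, i.e.
  -- functors C_P → k-Mod (modules at a fixed universe level m, ℓm)

  module _ (P : BoolPoset) (m ℓm : Level) where
    open BoolPoset P using (_≤_; ≤-refl; ≤-trans)

    record Functor : Set (c ⊔ ℓ ⊔ suc (m ⊔ ℓm)) where
      field
        obj    : Carrier P → Module k m ℓm
        hom    : ∀ {p q} → .(p ≤ q) → LinMap (obj p) (obj q)
        hom-id : ∀ p x → Module._≈ᴹ_ (obj p) (⟦ hom (≤-refl p) ⟧ x) x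
        hom-∘  : ∀ {p q r} .(h : p ≤ q) .(h' : q ≤ r) x →
                 Module._≈ᴹ_ (obj r) (⟦ hom (≤-trans h h') ⟧ x) (⟦ hom h' ⟧ (⟦ hom h ⟧ x))
    open Functor public

  module _ {P : BoolPoset} {m ℓm : Level} where
    open BoolPoset P using (_≤_; ≤-refl; ≤-trans)

    record NatTrans (A B : Functor P m ℓm) : Set (c ⊔ ℓ ⊔ m ⊔ ℓm) where
      field
        η       : ∀ p → LinMap (obj A p) (obj B p)
        natural : ∀ {p q} .(h : p ≤ q) x →
                  Module._≈ᴹ_ (obj B q) (⟦ hom B h ⟧ (⟦ η p ⟧ x)) (⟦ η q ⟧ (⟦ hom A h ⟧ x))
    open NatTrans public

    _≈ⁿ_ : ∀ {A B} → NatTrans A B → NatTrans A B → Set (m ⊔ ℓm)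
    _≈ⁿ_ {A} {B} α β = ∀ p x → Module._≈ᴹ_ (obj B p) (⟦ η α p ⟧ x) (⟦ η β p ⟧ x)

    idⁿ : (A : Functor P m ℓm) → NatTrans A A
    idⁿ A = record { η = λ p → idLin (obj A p) ; natural = λ h x → Module.≈ᴹ-refl (obj A _) }

    _∘ⁿ_ : ∀ {A B C} → NatTrans B C → NatTrans A B → NatTrans A C
    _∘ⁿ_ {A} {B} {C} β α = record
      { η = λ p → η β p ∘Lin η α p
      ; natural = λ {p} {q} h x → Module.≈ᴹ-trans (obj C q) (natural β h (⟦ η α p ⟧ x))
                    (IsModuleHomomorphism.⟦⟧-cong (isLin (η β q)) (natural α h x))
      }

    record _≅_ (A B : Functor P m ℓm) : Set (c ⊔ ℓ ⊔ m ⊔ ℓm) where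
      field
        to     : NatTrans A B
        from   : NatTrans B A
        from∘to : (from ∘ⁿ to) ≈ⁿ idⁿ A
        to∘from : (to ∘ⁿ from) ≈ⁿ idⁿ B

    -- A --α--> B --β--> C is exact at B (computed pointwise, as the
    -- abelian structure of F_{P,k} is pointwise): im α = ker β
    ExactAt : ∀ {A B C} → NatTrans A B → NatTrans B C → Set (m ⊔ ℓm)
    ExactAt {A} {B} {C} α β = ∀ p →
      (∀ a → Module._≈ᴹ_ (obj C p) (⟦ η β p ⟧ (⟦ η α p ⟧ a)) (Module.0ᴹ (obj C p)))
      × (∀ b → Module._≈ᴹ_ (obj C p) (⟦ η β p ⟧ b) (Module.0ᴹ (obj C p)) →
               ∃ λ a → Module._≈ᴹ_ (obj B p) (⟦ η α p ⟧ a) b)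

  record FFunctor (P Q : BoolPoset) (m ℓm : Level) : Set (c ⊔ ℓ ⊔ suc (m ⊔ ℓm)) where
    field
      F₀   : Functor P m ℓm → Functor Q m ℓm
      F₁   : ∀ {A B} → NatTrans A B → NatTrans (F₀ A) (F₀ B)
      F-id : ∀ A → F₁ (idⁿ A) ≈ⁿ idⁿ (F₀ A)
      F-∘  : ∀ {A B C} (β : NatTrans B C) (α : NatTrans A B) →
             F₁ (β ∘ⁿ α) ≈ⁿ (F₁ β ∘ⁿ F₁ α)
  open FFunctor public

  IsExact : ∀ {P Q m ℓm} → FFunctor P Q m ℓm → Set (c ⊔ ℓ ⊔ suc (m ⊔ ℓm))
  IsExact G = ∀ {A B C} (α : NatTrans A B) (β : NatTrans B C) →
              ExactAt α β → ExactAt (F₁ G α) (F₁ G β)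

  -- injective functors  I_p = Hom_{kC_P}(-,p)^* ,
  -- I_p(z) = Hom_k(k Hom(z,p), k) ≅ k if z ≤ p and 0 otherwise

  kᴹ : Module k c ℓ
  kᴹ = TensorUnit.⟨module⟩

  I : (P : BoolPoset) → Carrier P → Functor P c ℓ
  I P p = record
    { obj    = λ z → Πᴹ (z ≤ p) (λ _ → kᴹ)
    ; hom    = λ h → Πmap (λ h' → ≤-trans h h') (λ _ → idLin kᴹ)
    ; hom-id = λ z x a → K.refl
    ; hom-∘  = λ h h' x a → K.refl
    }
    where open BoolPoset P using (_≤_; ≤-refl; ≤-trans)

  module _ {X Y : BoolPoset} (𝔽 : ToJ X Y) (y : Carrier Y) {m ℓm : Level} where
    open ToJ 𝔽
    private
      ≤Γ : ∀ {p q : Carrier (Γ 𝔽)} → BoolPoset._≤_ (Γ 𝔽) p q →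
           (proj₁ (elt p) X.≤ proj₁ (elt q)) × (proj₂ (elt p) Y.≤ proj₂ (elt q))
      ≤Γ h = Equivalence.to T-∧ h

    res₀ : Functor (Γ 𝔽) m ℓm → Functor (Fᴾ 𝔽 y) m ℓm
    res₀ ψ = record
      { obj    = λ x → obj ψ (incl 𝔽 y x)
      ; hom    = λ h → hom ψ (Equivalence.from T-∧ (h , Y.≤-refl y))
      ; hom-id = λ x v → hom-id ψ (incl 𝔽 y x) v
      ; hom-∘  = λ h h' v → hom-∘ ψ (Equivalence.from T-∧ (h , Y.≤-refl y))
                                    (Equivalence.from T-∧ (h' , Y.≤-refl y)) v
      }

    res₁ : ∀ {A B} → NatTrans A B → NatTrans (res₀ A) (res₀ B)
    res₁ α = record
      { η       = λ x → η α (incl 𝔽 y x)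
      ; natural = λ h v → natural α (Equivalence.from T-∧ (h , Y.≤-refl y)) v
      }

    res : FFunctor (Γ 𝔽) (Fᴾ 𝔽 y) m ℓm
    res = record
      { F₀ = res₀
      ; F₁ = res₁
      ; F-id = λ A x v → Module.≈ᴹ-refl (obj A (incl 𝔽 y x))
      ; F-∘  = λ {A} {B} {C} β α x v → Module.≈ᴹ-refl (obj C (incl 𝔽 y x))
      }

    -- (i_y)_⋆ φ (a,b) = Hom_k(k Hom_Γ((a,b),(a,y)), φ(a)),
    -- which is ≅ φ(a) if b ≤ y and 0 otherwise; a morphism
    -- (a,b) → (c,d) acts by φ(a → c) (and is 0 unless d ≤ y)
    -- the family a ↦ φ(a) over the proposition b ≤ y, at p = (a,b)
    pushFam : Functor (Fᴾ 𝔽 y) m ℓm → (p : Carrier (Γ 𝔽)) → .(proj₂ (elt p) Y.≤ y) → Module k m ℓm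
    pushFam φ ⟨ (a , b) , m ⟩ h = obj φ ⟨ a , mono h a m ⟩

    push₀ : Functor (Fᴾ 𝔽 y) m ℓm → Functor (Γ 𝔽) m ℓm
    push₀ φ = record
      { obj    = λ p → Πᴹ (proj₂ (elt p) Y.≤ y) (pushFam φ p)
      ; hom    = λ {p} {q} h → Πmap {M = pushFam φ p} {N = pushFam φ q}
                                    (λ h' → Y.≤-trans (proj₂ (≤Γ {p} {q} h)) h')
                                    (λ h' → hom φ (proj₁ (≤Γ {p} {q} h)))
      ; hom-id = λ p v h' → hom-id φ _ (v h')
      ; hom-∘  = λ {p} {q} {r} h h' v b → hom-∘ φ (proj₁ (≤Γ {p} {q} h)) (proj₁ (≤Γ {q} {r} h')) (v _)
      }

    push₁ : ∀ {A B} → NatTrans A B → NatTrans (push₀ A) (push₀ B)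
    push₁ {A} {B} α = record
      { η       = λ p → Πmap {M = pushFam A p} {N = pushFam B p} (λ h → h) (λ h → η α _)
      ; natural = λ {p} {q} h v b → natural α (proj₁ (≤Γ {p} {q} h)) (v _)
      }

    push : FFunctor (Fᴾ 𝔽 y) (Γ 𝔽) m ℓm
    push = record
      { F₀ = push₀
      ; F₁ = push₁
      ; F-id = λ A p v b → Module.≈ᴹ-refl (pushFam A p b)
      ; F-∘  = λ {A} {B} {C} β α p v b → Module.≈ᴹ-refl (pushFam C p b)
      }

-- At (a, b) ∈ Γ, (i_y)_⋆ I_x consists
-- of the k-valued functions of proofs of b ≤ y and of a ≤ x, while
-- I_(x,y) consists of those of proofs of (a, b) ≤ (x, y); as Γ carries the
-- product order, currying identifies the two, naturally in (a, b).
-- Restriction is exact because its components are components of the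
-- original transformations; (i_y)_⋆ is exact because at each point it is
-- a product over the decidable proposition b ≤ y, hence either the
-- component of φ at a or zero.
module Submission where

open import Defs
open import Level using (Level; _⊔_)
open import Data.Product using (_×_; _,_; ∃; proj₁; proj₂; swap)
open import Data.Bool using (T?)
open import Data.Bool.Properties using (T-∧)
open import Data.Empty using (⊥-elim-irr)
open import Relation.Nullary using (Dec; yes; no)
open import Function.Base using (_∘_; id)
open import Function.Bundles using (Equivalence)
open import Algebra.Bundles using (CommutativeRing)
open import Algebra.Module.Bundles using (Module)

module _ {c ℓ : Level} (k : CommutativeRing c ℓ) where

  module _ {m ℓm : Level} {A B : Set} (M : Module k m ℓm) where
    open Module M

    Πᴹ-uncurry : LinMap k (Πᴹ k A λ _ → Πᴹ k B λ _ → M) (Πᴹ k (A × B) λ _ → M)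
    Πᴹ-uncurry = mkLin (λ s p → s (proj₁ p) (proj₂ p)) (record
      { isBimoduleHomomorphism = record
        { +ᴹ-isGroupHomomorphism = record
          { isMonoidHomomorphism = record
            { isMagmaHomomorphism = record
              { isRelHomomorphism = record { cong = λ e p → e (proj₁ p) (proj₂ p) }
              ; homo = λ s t p → ≈ᴹ-refl }
            ; ε-homo = λ p → ≈ᴹ-refl }
          ; ⁻¹-homo = λ s p → ≈ᴹ-refl }
        ; *ₗ-homo = λ r s p → ≈ᴹ-refl
        ; *ᵣ-homo = λ r s p → ≈ᴹ-refl } })

    Πᴹ-curry : LinMap k (Πᴹ k (A × B) λ _ → M) (Πᴹ k A λ _ → Πᴹ k B λ _ → M)
    Πᴹ-curry = mkLin (λ s a b → s (a , b)) (record
      { isBimoduleHomomorphism = record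
        { +ᴹ-isGroupHomomorphism = record
          { isMonoidHomomorphism = record
            { isMagmaHomomorphism = record
              { isRelHomomorphism = record { cong = λ e a b → e (a , b) }
              ; homo = λ s t a b → ≈ᴹ-refl }
            ; ε-homo = λ a b → ≈ᴹ-refl }
          ; ⁻¹-homo = λ s a b → ≈ᴹ-refl }
        ; *ₗ-homo = λ r s a b → ≈ᴹ-refl
        ; *ᵣ-homo = λ r s a b → ≈ᴹ-refl } })

    Πᴹ-reindex : .(B → A) → LinMap k (Πᴹ k A λ _ → M) (Πᴹ k B λ _ → M)
    Πᴹ-reindex τ = Πmap k τ (λ _ → idLin k M)

  module _ {m ℓm : Level} {M N P : Module k m ℓm} where
    open Module P using (_≈ᴹ_; 0ᴹ)

    Exact : LinMap k M N → LinMap k N P → Set (m ⊔ ℓm)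
    Exact f g = (∀ a → ⟦ g ⟧ (⟦ f ⟧ a) ≈ᴹ 0ᴹ)
              × (∀ b → ⟦ g ⟧ b ≈ᴹ 0ᴹ → ∃ λ a → Module._≈ᴹ_ N (⟦ f ⟧ a) b)

  Πmap-exact : ∀ {m ℓm} {A : Set} {M N P : .A → Module k m ℓm} → Dec A →
    (f : .(a : A) → LinMap k (M a) (N a)) (g : .(a : A) → LinMap k (N a) (P a)) →
    (.(a : A) → Exact (f a) (g a)) → Exact (Πmap k id f) (Πmap k id g)
  Πmap-exact {A = A} {M} {N} {P} A? f g exact = (λ s a → proj₁ (exact a) (s a)) , preimage A?
    where
    open Module
    preimage : Dec A → ∀ t → _≈ᴹ_ (Πᴹ k A P) (⟦ Πmap k id g ⟧ t) (0ᴹ (Πᴹ k A P)) →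
               ∃ λ s → _≈ᴹ_ (Πᴹ k A N) (⟦ Πmap k id f ⟧ s) t
    preimage (yes a) t gt≈0 = (λ _ → proj₁ s) , (λ _ → proj₂ s)
      where s = proj₂ (exact a) (t a) (gt≈0 a)
    preimage (no ¬a) t gt≈0 = (λ a → ⊥-elim-irr (¬a a)) , (λ a → ⊥-elim-irr (¬a a))

  module _ {X Y : BoolPoset} (𝔽 : ToJ X Y) (y : Carrier Y) where
    open ToJ 𝔽 using (mono)
    open BoolPoset Y using (leq; _≤_)

    res-exact : ∀ {m ℓm} → IsExact k (res k 𝔽 y {m} {ℓm})
    res-exact α β exact x = exact (incl 𝔽 y x)

    push-exact : ∀ {m ℓm} → IsExact k (push k 𝔽 y {m} {ℓm})
    push-exact α β exact ⟨ (a , b) , a∈Fb ⟩ =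
      Πmap-exact (T? (leq b y)) (λ b≤y → η α (a∈F b≤y)) (λ b≤y → η β (a∈F b≤y))
        (λ b≤y → exact (a∈F b≤y))
      where
      a∈F : .(b ≤ y) → Carrier (Fᴾ 𝔽 y)
      a∈F b≤y = ⟨ a , mono b≤y a a∈Fb ⟩

    push-I≅I : (x : Carrier (Fᴾ 𝔽 y)) →
               _≅_ k (F₀ (push k 𝔽 y) (I k (Fᴾ 𝔽 y) x)) (I k (Γ 𝔽) (incl 𝔽 y x))
    -- Both components only rearrange irrelevant order proofs, so every
    -- required identity holds definitionally.
    push-I≅I x = record
      { to      = record { η = uncurryΓ ; natural = λ h v h' → K.refl }
      ; from    = record { η = curryΓ ; natural = λ h v b≤y a≤x → K.refl }
      ; from∘to = λ p v b≤y a≤x → K.refl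
      ; to∘from = λ p v h → K.refl
      }
      where
      module K = CommutativeRing k
      pushI IΓ : Functor k (Γ 𝔽) c ℓ
      pushI = F₀ (push k 𝔽 y) (I k (Fᴾ 𝔽 y) x)
      IΓ = I k (Γ 𝔽) (incl 𝔽 y x)

      uncurryΓ : ∀ p → LinMap k (obj pushI p) (obj IΓ p)
      uncurryΓ p = _∘Lin_ k (Πᴹ-reindex (kᴹ k) (swap ∘ Equivalence.to T-∧)) (Πᴹ-uncurry (kᴹ k))

      curryΓ : ∀ p → LinMap k (obj IΓ p) (obj pushI p)
      curryΓ p = _∘Lin_ k (Πᴹ-curry (kᴹ k)) (Πᴹ-reindex (kᴹ k) (Equivalence.from T-∧ ∘ swap))

lemma4p3 : {c ℓ m ℓm : Level} (k : CommutativeRing c ℓ)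
    (X Y : BoolPoset) → IsFinite X → IsFinite Y →
    (𝔽 : ToJ X Y) (y : Carrier Y) →
    ((x : Carrier (Fᴾ 𝔽 y)) →
    _≅_ k (F₀ (push k 𝔽 y) (I k (Fᴾ 𝔽 y) x)) (I k (Γ 𝔽) (incl 𝔽 y x)))
    × (IsExact k (res k 𝔽 y {m} {ℓm}) × IsExact k (push k 𝔽 y {m} {ℓm}))
lemma4p3 k X Y _ _ 𝔽 y = push-I≅I k 𝔽 y , res-exact k 𝔽 y , push-exact k 𝔽 y
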